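{- Let $R_1$ and $R_2$ be finite commutative local principal ideal rings with unity and $R=R_1\times R_2$ such that $\mathrm{diam}(\Gamma(R_1))\in\{1,2\}$ and $\mathrm{diam}(\Gamma(R_2))=2$. Then $\overline{\Gamma(R)}$ is not a divisor graph.
   Context: For a commutative ring $S$ with unity, $Z(S)$ is its set of zero divisors. The zero divisor graph $\Gamma(S)$ has vertex set $Z(S)\setminus\{0\}$, distinct $a,b$ adjacent iff $ab=0$; its complement $\overline{\Gamma(S)}$ has the same vertex set, distinct $a,b$ adjacent iff $ab\neq0$. The diameter $\mathrm{diam}$ of a graph is the maximum distance between two of its vertices. A local ring has a unique maximal ideal. A graph $G$ is a divisor graph if it is isomorphic to the graph $G(S)$ on some set $S$ of positive integers in which distinct $i,j$ are adjacent iff $i\mid j$ or $j\mid i$. -}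

module Defs where

open import Level using (0ℓ)
open import Data.Nat using (ℕ; zero; suc; _<_; _≤_)
open import Data.Nat.Divisibility using (_∣_)
open import Data.Fin using (Fin)
open import Data.Product using (Σ; ∃; ∃-syntax; _×_; _,_; proj₁)
open import Data.Sum using (_⊎_)
open import Relation.Nullary using (¬_; Dec)
open import Function.Bundles using (_⇔_)
open import Relation.Binary.PropositionalEquality using (_≡_)
open import Algebra.Bundles using (CommutativeRing)
import Algebra.Construct.DirectProduct as DP

record Graph : Set₁ where
  field
    V    : Set
    _≈V_ : V → V → Set
    Adj  : V → V → Set

module _ (G : Graph) where
  open Graph G

  Walk : ℕ → V → V → Set
  Walk zero    u v = u ≈V v
  Walk (suc k) u v = ∃[ w ] (Adj u w × Walk k w v)

  DistLe : ℕ → V → V → Set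
  DistLe d u v = ∃[ k ] (k ≤ d × Walk k u v)

  HasDiam : ℕ → Set
  HasDiam d = (∀ u v → DistLe d u v)
            × ∃[ u ] ∃[ v ] (DistLe d u v × (∀ k → k < d → ¬ Walk k u v))

  -- divisor graph: isomorphic to G(S) for a set S of positive integers;
  -- f is the isomorphism onto its image S = f(V)
  IsDivisorGraph : Set
  IsDivisorGraph =
    Σ (V → ℕ) λ f →
        (∀ v → 0 < f v)
      × (∀ u v → (u ≈V v) ⇔ (f u ≡ f v))
      × (∀ u v → Adj u v ⇔ (¬ (f u ≡ f v) × (f u ∣ f v ⊎ f v ∣ f u)))

CRing : Set₁
CRing = CommutativeRing 0ℓ 0ℓ

module _ (R : CRing) where
  open CommutativeRing R

  IsFinite : Set
  IsFinite = (∀ x y → Dec (x ≈ y))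
           × ∃[ n ] Σ (Fin n → Carrier) λ e → ∀ x → ∃[ i ] (e i ≈ x)

  record Ideal : Set₁ where
    field
      mem      : Carrier → Set
      mem-resp : ∀ {x y} → x ≈ y → mem x → mem y
      mem-0    : mem 0#
      mem-+    : ∀ {x y} → mem x → mem y → mem (x + y)
      mem-*    : ∀ r {x} → mem x → mem (r * x)

  open Ideal public

  _⊆I_ : Ideal → Ideal → Set
  I ⊆I J = ∀ x → mem I x → mem J x

  IsMaximal : Ideal → Set₁
  IsMaximal M = ¬ mem M 1#
              × (∀ (J : Ideal) → M ⊆I J → (J ⊆I M) ⊎ mem J 1#)

  IsLocal : Set₁
  IsLocal = Σ Ideal λ M → IsMaximal M × (∀ N → IsMaximal N → (N ⊆I M) × (M ⊆I N))

  IsPIR : Set₁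
  IsPIR = ∀ (I : Ideal) → ∃[ a ] (∀ x → mem I x ⇔ (∃[ r ] (x ≈ r * a)))

  IsZeroDivisor : Carrier → Set
  IsZeroDivisor a = ∃[ b ] (¬ (b ≈ 0#) × (a * b ≈ 0#))

  ZVertex : Set
  ZVertex = Σ Carrier λ a → IsZeroDivisor a × ¬ (a ≈ 0#)

  Γ : Graph
  Γ = record
    { V    = ZVertex
    ; _≈V_ = λ u v → proj₁ u ≈ proj₁ v
    ; Adj  = λ u v → ¬ (proj₁ u ≈ proj₁ v)
                   × (proj₁ u * proj₁ v ≈ 0#)
    }

  Γᶜ : Graph
  Γᶜ = record
    { V    = ZVertex
    ; _≈V_ = λ u v → proj₁ u ≈ proj₁ v
    ; Adj  = λ u v → ¬ (proj₁ u ≈ proj₁ v)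
                   × ¬ (proj₁ u * proj₁ v ≈ 0#)
    }

_×R_ : CRing → CRing → CRing
R₁ ×R R₂ = DP.commutativeRing R₁ R₂

module Submission where

open import Defs
open import Data.Nat using (ℕ; _≟_; s≤s; z≤n)
open import Data.Nat.Divisibility using (_∣_; ∣-trans; ∣-antisym)
open import Data.Product using (∃-syntax; _×_; _,_; proj₁; proj₂)
open import Data.Sum using (_⊎_; inj₁; inj₂; swap; [_,_])
open import Data.Empty using (⊥)
open import Function using (flip; _∘_)
open import Function.Bundles using (_⇔_; Equivalence)
open import Relation.Nullary using (¬_)
open import Relation.Nullary.Decidable using (decidable-stable)
open import Relation.Binary.Definitions using (Symmetric)
open import Relation.Binary.PropositionalEquality as ≡ using (_≡_)
open import Algebra.Bundles using (CommutativeRing)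
import Relation.Binary.Reasoning.Setoid as ≈-Reasoning

{-
A divisor graph is the comparability graph of the divisibility order, so
orienting each edge u — v as u → v when f u ∣ f v gives a transitive
orientation.  In a transitive orientation, two edges v — u and v — w with u, w
non-adjacent must both point away from v or both point into v (Γ-forcing).
In the complement of Γ(R₁ × R₂) we exhibit eight vertices along which forcing
propagates the orientation of the edge p — q all the way round to the opposite
orientation, which is impossible.  Only a nonzero zero divisor a of R₁ and two
distinct zero divisors b, c of R₂ with b c ≠ 0 (which exist as diam Γ(R₂) = 2)
are needed.
-}

module _ (G : Graph) where
  open Graph G

  HasDiam⇒vertex : ∀ {d} → HasDiam G d → V
  HasDiam⇒vertex (_ , u , _) = u

  record ClosedUnderForcing (D : V → V → Set) : Set where
    field
      at-source : ∀ {u v w} → Adj v u → Adj v w → ¬ Adj u w → D v u → D v w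
      at-target : ∀ {u v w} → Adj u v → Adj w v → ¬ Adj u w → D u v → D w v

  converse-closedUnderForcing : Symmetric Adj → ∀ {D} →
    ClosedUnderForcing D → ClosedUnderForcing (flip D)
  converse-closedUnderForcing adj-sym closed = record
    { at-source = λ vu vw → at-target (adj-sym vu) (adj-sym vw)
    ; at-target = λ uv wv → at-source (adj-sym uv) (adj-sym wv)
    }
    where open ClosedUnderForcing closed

  record ForcingCycle : Set where
    field
      p q s t u w x y : V
      p—q : Adj p q
      p—s : Adj p s
      p—t : Adj p t
      u—t : Adj u t
      w—t : Adj w t
      w—x : Adj w x
      w—y : Adj w y
      w—p : Adj w p
      q≁s : ¬ Adj q s
      s≁t : ¬ Adj s t
      p≁u : ¬ Adj p u
      u≁w : ¬ Adj u w
      t≁x : ¬ Adj t x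
      x≁y : ¬ Adj x y
      y≁p : ¬ Adj y p
      w≁q : ¬ Adj w q

  forcing-reverses : Symmetric Adj → (C : ForcingCycle) → ∀ {D} →
    ClosedUnderForcing D → D (ForcingCycle.p C) (ForcingCycle.q C) →
    D (ForcingCycle.q C) (ForcingCycle.p C)
  forcing-reverses adj-sym C closed p→q =
    let p→s = at-source p—q p—s q≁s p→q
        p→t = at-source p—s p—t s≁t p→s
        u→t = at-target p—t u—t p≁u p→t
        w→t = at-target u—t w—t u≁w u→t
        w→x = at-source w—t w—x t≁x w→t
        w→y = at-source w—x w—y x≁y w→x
        w→p = at-source w—y w—p y≁p w→y
    in at-target w—p (adj-sym p—q) w≁q w→p
    where
    open ClosedUnderForcing closed
    open ForcingCycle C

module _ {G : Graph} where
  open Graph G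

  module DivisorLabelling (f : V → ℕ)
    (adj⇔ : ∀ u v → Adj u v ⇔ (¬ (f u ≡ f v) × (f u ∣ f v ⊎ f v ∣ f u))) where
    open Equivalence

    adj⇒≢ : ∀ {u v} → Adj u v → ¬ (f u ≡ f v)
    adj⇒≢ {u} {v} = proj₁ ∘ to (adj⇔ u v)

    adj⇒comparable : ∀ {u v} → Adj u v → f u ∣ f v ⊎ f v ∣ f u
    adj⇒comparable {u} {v} = proj₂ ∘ to (adj⇔ u v)

    adj-sym : Symmetric Adj
    adj-sym {u} {v} uv = from (adj⇔ v u) (adj⇒≢ uv ∘ ≡.sym , swap (adj⇒comparable uv))

    non-adjacent-comparable⇒≡ : ∀ {u v} → ¬ Adj u v → f u ∣ f v ⊎ f v ∣ f u → f u ≡ f v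
    non-adjacent-comparable⇒≡ {u} {v} u≁v comparable =
      decidable-stable (f u ≟ f v) λ u≢v → u≁v (from (adj⇔ u v) (u≢v , comparable))

    divides-closedUnderForcing : ClosedUnderForcing G (λ u v → f u ∣ f v)
    divides-closedUnderForcing = record { at-source = at-source ; at-target = at-target }
      where
      at-source : ∀ {u v w} → Adj v u → Adj v w → ¬ Adj u w → f v ∣ f u → f v ∣ f w
      at-source {u} vu vw u≁w v∣u with adj⇒comparable vw
      ... | inj₁ v∣w = v∣w
      ... | inj₂ w∣v =
        ≡.subst (f _ ∣_) (non-adjacent-comparable⇒≡ u≁w (inj₂ (∣-trans w∣v v∣u))) v∣u

      at-target : ∀ {u v w} → Adj u v → Adj w v → ¬ Adj u w → f u ∣ f v → f w ∣ f v
      at-target uv wv u≁w u∣v with adj⇒comparable wv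
      ... | inj₁ w∣v = w∣v
      ... | inj₂ v∣w =
        ≡.subst (_∣ f _) (non-adjacent-comparable⇒≡ u≁w (inj₁ (∣-trans u∣v v∣w))) u∣v

  ForcingCycle⇒¬IsDivisorGraph : ForcingCycle G → ¬ IsDivisorGraph G
  ForcingCycle⇒¬IsDivisorGraph C (f , _ , _ , adj⇔) = orient (adj⇒comparable p—q)
    where
    open DivisorLabelling f adj⇔
    open ForcingCycle C

    reverses : ∀ {D} → ClosedUnderForcing G D → D p q → D q p
    reverses = forcing-reverses G adj-sym C

    orient : f p ∣ f q ⊎ f q ∣ f p → ⊥
    orient (inj₁ p∣q) = adj⇒≢ p—q (∣-antisym p∣q (reverses divides-closedUnderForcing p∣q))
    orient (inj₂ q∣p) = adj⇒≢ p—q (∣-antisym (reverses flipped q∣p) q∣p)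
      where
      flipped : ClosedUnderForcing G (λ u v → f v ∣ f u)
      flipped = converse-closedUnderForcing G adj-sym divides-closedUnderForcing

module _ (R : CRing) where
  open CommutativeRing R

  ≉0-resp : ∀ {x y} → x ≈ y → ¬ x ≈ 0# → ¬ y ≈ 0#
  ≉0-resp x≈y x≉0 y≈0 = x≉0 (trans x≈y y≈0)

  ≉0⇒1≉0 : ∀ {x} → ¬ x ≈ 0# → ¬ 1# ≈ 0#
  ≉0⇒1≉0 {x} x≉0 1≈0 = x≉0 (begin
    x       ≈⟨ *-identityʳ x ⟨
    x * 1#  ≈⟨ *-congˡ 1≈0 ⟩
    x * 0#  ≈⟨ zeroʳ x ⟩
    0#      ∎)
    where open ≈-Reasoning setoid

  zero-divisor≉1 : ∀ {x y} → x * y ≈ 0# → ¬ y ≈ 0# → ¬ x ≈ 1#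
  zero-divisor≉1 {x} {y} xy≈0 y≉0 x≈1 = y≉0 (begin
    y       ≈⟨ *-identityˡ y ⟨
    1# * y  ≈⟨ *-congʳ x≈1 ⟨
    x * y   ≈⟨ xy≈0 ⟩
    0#      ∎)
    where open ≈-Reasoning setoid

  *-identityˡ-≉0 : ∀ {x} → ¬ x ≈ 0# → ¬ 1# * x ≈ 0#
  *-identityˡ-≉0 = ≉0-resp (sym (*-identityˡ _))

  *-identityʳ-≉0 : ∀ {x} → ¬ x ≈ 0# → ¬ x * 1# ≈ 0#
  *-identityʳ-≉0 = ≉0-resp (sym (*-identityʳ _))

  *≈0⇒*-*≈0 : ∀ {x y} z → x * y ≈ 0# → x * (y * z) ≈ 0#
  *≈0⇒*-*≈0 {x} {y} z xy≈0 = begin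
    x * (y * z)  ≈⟨ *-assoc x y z ⟨
    x * y * z    ≈⟨ *-congʳ xy≈0 ⟩
    0# * z       ≈⟨ zeroˡ z ⟩
    0#           ∎
    where open ≈-Reasoning setoid

  *≈0⇒**≈0 : ∀ {y z} x → y * z ≈ 0# → x * y * z ≈ 0#
  *≈0⇒**≈0 {y} {z} x yz≈0 = begin
    x * y * z    ≈⟨ *-assoc x y z ⟩
    x * (y * z)  ≈⟨ *-congˡ yz≈0 ⟩
    x * 0#       ≈⟨ zeroʳ x ⟩
    0#           ∎
    where open ≈-Reasoning setoid

  *≈0⇒≁ᶜ : ∀ {x y} → x * y ≈ 0# → ¬ (¬ x ≈ y × ¬ x * y ≈ 0#)
  *≈0⇒≁ᶜ xy≈0 (_ , xy≉0) = xy≉0 xy≈0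

  diam-2⇒Γᶜ-edge : HasDiam (Γ R) 2 → ∃[ u ] ∃[ v ] Graph.Adj (Γᶜ R) u v
  diam-2⇒Γᶜ-edge (_ , u , v , _ , far) =
    u , v , u≉v , λ uv≈0 → far 1 (s≤s (s≤s z≤n)) (v , (u≉v , uv≈0) , refl)
    where
    u≉v : ¬ proj₁ u ≈ proj₁ v
    u≉v = far 0 (s≤s z≤n)

module _ (R₁ R₂ : CRing) where
  private
    module A = CommutativeRing R₁
    module B = CommutativeRing R₂

  left-vertex : ¬ B.1# B.≈ B.0# → ∀ {x} → ¬ x A.≈ A.0# → ZVertex (R₁ ×R R₂)
  left-vertex 1≉0 {x} x≉0 =
    (x , B.0#) , ((A.0# , B.1#) , 1≉0 ∘ proj₂ , (A.zeroʳ x , B.zeroˡ B.1#)) , x≉0 ∘ proj₁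

  right-vertex : ¬ A.1# A.≈ A.0# → ∀ {y} → ¬ y B.≈ B.0# → ZVertex (R₁ ×R R₂)
  right-vertex 1≉0 {y} y≉0 =
    (A.0# , y) , ((A.1# , B.0#) , 1≉0 ∘ proj₁ , (A.zeroˡ A.1# , B.zeroʳ y)) , y≉0 ∘ proj₂

  -- With a a' = 0 in R₁ and b b' = c c' = 0, b c ≠ 0 in R₂, the cycle is
  -- p = (0,1), q = (0,b'), s = (0,bc), t = (1,c'), u = (a,0), w = (a',b),
  -- x = (0,c), y = (1,0).
  Γᶜ-×R-forcingCycle : ZVertex R₁ → ∃[ b ] ∃[ c ] Graph.Adj (Γᶜ R₂) b c →
                       ForcingCycle (Γᶜ (R₁ ×R R₂))
  Γᶜ-×R-forcingCycle (a , (a' , a'≉0 , aa'≈0) , a≉0)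
                     ((b , (b' , b'≉0 , bb'≈0) , b≉0) , (c , (c' , c'≉0 , cc'≈0) , c≉0) , b≉c , bc≉0)
    = record
    { p = right-vertex 1≉0ᴬ 1≉0ᴮ
    ; q = right-vertex 1≉0ᴬ b'≉0
    ; s = right-vertex 1≉0ᴬ bc≉0
    ; t = (A.1# , c') , ((A.0# , c) , c≉0 ∘ proj₂ , (A.zeroʳ A.1# , c'c≈0)) , 1≉0ᴬ ∘ proj₁
    ; u = left-vertex 1≉0ᴮ a≉0
    ; w = (a' , b) , ((a , b') , b'≉0 ∘ proj₂ , (a'a≈0 , bb'≈0)) , a'≉0 ∘ proj₁
    ; x = right-vertex 1≉0ᴬ c≉0
    ; y = left-vertex 1≉0ᴮ 1≉0ᴬ
    ; p—q = zero-divisor≉1 R₂ b'b≈0 b≉0 ∘ B.sym ∘ proj₂ , *-identityˡ-≉0 R₂ b'≉0 ∘ proj₂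
    ; p—s = zero-divisor≉1 R₂ bcb'≈0 b'≉0 ∘ B.sym ∘ proj₂ , *-identityˡ-≉0 R₂ bc≉0 ∘ proj₂
    ; p—t = 1≉0ᴬ ∘ A.sym ∘ proj₁ , *-identityˡ-≉0 R₂ c'≉0 ∘ proj₂
    ; u—t = zero-divisor≉1 R₁ aa'≈0 a'≉0 ∘ proj₁ , *-identityʳ-≉0 R₁ a≉0 ∘ proj₁
    ; w—t = zero-divisor≉1 R₁ a'a≈0 a≉0 ∘ proj₁ , *-identityʳ-≉0 R₁ a'≉0 ∘ proj₁
    ; w—x = b≉c ∘ proj₂ , bc≉0 ∘ proj₂
    ; w—y = b≉0 ∘ proj₂ , *-identityʳ-≉0 R₁ a'≉0 ∘ proj₁
    ; w—p = a'≉0 ∘ proj₁ , *-identityʳ-≉0 R₂ b≉0 ∘ proj₂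
    ; q≁s = *≈0⇒≁ᶜ (R₁ ×R R₂) (A.zeroˡ A.0# , b'bc≈0)
    ; s≁t = *≈0⇒≁ᶜ (R₁ ×R R₂) (A.zeroˡ A.1# , *≈0⇒**≈0 R₂ b cc'≈0)
    ; p≁u = *≈0⇒≁ᶜ (R₁ ×R R₂) (A.zeroˡ a , B.zeroʳ B.1#)
    ; u≁w = *≈0⇒≁ᶜ (R₁ ×R R₂) (aa'≈0 , B.zeroˡ b)
    ; t≁x = *≈0⇒≁ᶜ (R₁ ×R R₂) (A.zeroʳ A.1# , c'c≈0)
    ; x≁y = *≈0⇒≁ᶜ (R₁ ×R R₂) (A.zeroˡ A.1# , B.zeroʳ c)
    ; y≁p = *≈0⇒≁ᶜ (R₁ ×R R₂) (A.zeroʳ A.1# , B.zeroˡ B.1#)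
    ; w≁q = *≈0⇒≁ᶜ (R₁ ×R R₂) (A.zeroʳ a' , bb'≈0)
    }
    where
    1≉0ᴬ : ¬ A.1# A.≈ A.0#
    1≉0ᴬ = ≉0⇒1≉0 R₁ a≉0
    1≉0ᴮ : ¬ B.1# B.≈ B.0#
    1≉0ᴮ = ≉0⇒1≉0 R₂ b≉0
    a'a≈0 : a' A.* a A.≈ A.0#
    a'a≈0 = A.trans (A.*-comm a' a) aa'≈0
    b'b≈0 : b' B.* b B.≈ B.0#
    b'b≈0 = B.trans (B.*-comm b' b) bb'≈0
    c'c≈0 : c' B.* c B.≈ B.0#
    c'c≈0 = B.trans (B.*-comm c' c) cc'≈0
    b'bc≈0 : b' B.* (b B.* c) B.≈ B.0#
    b'bc≈0 = *≈0⇒*-*≈0 R₂ c b'b≈0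
    bcb'≈0 : b B.* c B.* b' B.≈ B.0#
    bcb'≈0 = B.trans (B.*-comm (b B.* c) b') b'bc≈0

theorem2p6 : (R₁ R₂ : CRing)
    → IsFinite R₁ → IsLocal R₁ → IsPIR R₁
    → IsFinite R₂ → IsLocal R₂ → IsPIR R₂
    → HasDiam (Γ R₁) 1 ⊎ HasDiam (Γ R₁) 2
    → HasDiam (Γ R₂) 2
    → ¬ IsDivisorGraph (Γᶜ (R₁ ×R R₂))
theorem2p6 R₁ R₂ _ _ _ _ _ _ diam₁ diam₂ =
  ForcingCycle⇒¬IsDivisorGraph (Γᶜ-×R-forcingCycle R₁ R₂ a (diam-2⇒Γᶜ-edge R₂ diam₂))
  where
  a : ZVertex R₁
  a = [ HasDiam⇒vertex (Γ R₁) , HasDiam⇒vertex (Γ R₁) ] diam₁
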